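{- For every integer $k\ge 1$, the $k$-element vertex covers can be learned by equivalence queries in $2^{k\cdot 2^k}$ rounds, independently of the order of the graph. Concretely, there is a learning algorithm for the concept $\Phi_k$, defined by $\Phi_k(G,V')\iff$ "$V'$ is a vertex cover of $G$ and $|V'|=k$", which makes only equivalence queries with hypothesis graphs on $\{1,\dots,n\}$. For every $n$, every graph $G$ on $\{1,\dots,n\}$ and every competent Teacher, it obtains the answer "finished" after at most $2^{k\cdot 2^k}$ queries.
   Context: A vertex cover of a graph $G$ is a set $C\subseteq V(G)$ containing at least one endpoint of every edge of $G$. For a vertex set concept $\Phi$, the solution set is $S(G)=\{V':\Phi(G,V')\}$, and graphs $G,H$ are $\Phi$-equivalent if $V(G)=V(H)$ and $S(G)=S(H)$. Learning model (exact learning by equivalence queries): a Teacher privately holds a graph $G$ with vertex set $\{1,\dots,n\}$, and the Learner initially knows only $n$. In an equivalence query the Learner presents a hypothesis graph $H$ on $\{1,\dots,n\}$. If $H$ is $\Phi_k$-equivalent to $G$, the Teacher answers "finished". Otherwise the Teacher returns a counterexample: either a positive counterexample, i.e. a set $V'$ with $\Phi_k(G,V')$ true and $\Phi_k(H,V')$ false, or a negative counterexample, i.e. a set $V'$ with $\Phi_k(H,V')$ true and $\Phi_k(G,V')$ false. In particular, every counterexample has exactly $k$ elements. A Teacher is competent if it always answers correctly; it may choose any valid counterexample. -}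

module Defs where

open import Data.Nat using (ℕ; _<_; _*_; _^_; _≤_)
open import Data.Bool using (Bool; true; false)
open import Data.Fin using (Fin)
open import Data.Fin.Subset using (Subset; _∈_; ∣_∣)
open import Data.List using (List; []; _∷_; length)
open import Data.Product using (_×_; Σ; ∃)
open import Data.Sum using (_⊎_)
open import Relation.Nullary using (¬_)
open import Relation.Binary.PropositionalEquality using (_≡_)

-- A finite simple graph on the vertex set Fin n (standing for {1,…,n}):
-- a symmetric, irreflexive Boolean adjacency relation.
record Graph (n : ℕ) : Set where
  field
    adj   : Fin n → Fin n → Bool
    sym   : ∀ u v → adj u v ≡ adj v u
    irref : ∀ u → adj u u ≡ false
open Graph public

IsVertexCover : ∀ {n} → Graph n → Subset n → Set
IsVertexCover G C = ∀ u v → adj G u v ≡ true → (u ∈ C ⊎ v ∈ C)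

Φ : ℕ → ∀ {n} → Graph n → Subset n → Set
Φ k G V' = IsVertexCover G V' × ∣ V' ∣ ≡ k

Counterexample : ℕ → ∀ {n} → (G H : Graph n) → Subset n → Set
Counterexample k G H V' = (Φ k G V' × ¬ Φ k H V') ⊎ (Φ k H V' × ¬ Φ k G V')

-- A learner using only equivalence queries: knowing only n and the
-- counterexamples received so far (most recent first), it outputs the
-- next hypothesis graph on Fin n.
Learner : Set
Learner = (n : ℕ) → List (Subset n) → Graph n

-- A possible interaction between learner L and a competent Teacher holding G:
-- a history cs of counterexamples, each of which is a valid counterexample to
-- the hypothesis the learner presented at that point.  Every competent Teacher
-- (adaptive, arbitrary choice of counterexamples) produces such histories, and
-- every such history is produced by some competent Teacher.
data Run (k : ℕ) (L : Learner) (n : ℕ) (G : Graph n) : List (Subset n) → Set where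
  start : Run k L n G []
  step  : ∀ {cs c} → Run k L n G cs → Counterexample k G (L n cs) c → Run k L n G (c ∷ cs)

-- The learner always proposes the largest graph H of which all counterexamples
-- received so far are vertex covers. Inductively every counterexample is positive,
-- so H contains the target G, a cover of H is a cover of G, and the Teacher must
-- answer with a k-cover C of G missing some edge uv of H. That edge avoids C but
-- meets every earlier counterexample, so the counterexamples form a skew set-pair
-- system with pairs {u, v} and k-sets; splitting on u shows there are fewer than
-- 2^(k+1) ≤ 2^(k·2^k) of them.
module Submission where

open import Defs
open import Data.Nat using (ℕ; _<_; _≤_; _*_; _^_)
open import Data.Fin.Subset using (Subset)
open import Data.List using (List; length)
open import Data.Product using (Σ)

open import Level using (Level)
open import Function using (_∘_; mk⇔)
open import Data.Nat using (zero; suc; _+_; z≤n; s≤s)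
open import Data.Nat.Properties
  using (≤-trans; n<1+n; ≤-pred; ≤-reflexive; <-≤-trans; +-suc; +-identityʳ; +-comm;
         +-mono-≤; +-monoʳ-≤; *-monoʳ-≤; *-comm; m^n>0; ^-monoʳ-≤; module ≤-Reasoning)
import Data.Bool as Bool
open import Data.Bool using (true; false)
open import Data.Fin using (Fin; _≟_)
open import Data.Fin.Subset using (_∈_; _∉_; ∣_∣; _-_)
open import Data.Fin.Subset.Properties using (_∈?_; x∈p⇒∣p-x∣<∣p∣; p─q⊆p; x∈p∧x≢y⇒x∈p-y)
open import Data.Fin.Properties using (all?; ¬∀⟶∃¬)
open import Data.List using ([]; _∷_; map; filter)
open import Data.List.Properties using (length-map)
open import Data.List.Relation.Unary.All as All using (All; []; _∷_)
open import Data.List.Relation.Unary.All.Properties using (map⁺; filter⁺; all-filter)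
open import Data.Product using (_×_; _,_; proj₁; proj₂; ∃₂; uncurry)
open import Data.Sum as Sum using (_⊎_; inj₁; inj₂; [_,_])
open import Relation.Nullary using (¬_; Dec; does; proof; Reflects; invert; contradiction; ¬?)
open import Relation.Nullary.Decidable using (_×-dec_; _⊎-dec_; _→-dec_; dec-true; dec-false; does-⇔; decidable-stable)
open import Relation.Unary using (Pred; Decidable)
open import Relation.Unary.Properties using (∁?)
import Relation.Binary.PropositionalEquality as ≡
open import Relation.Binary.PropositionalEquality using (_≡_; _≢_; refl; trans; cong; subst)

private
  variable
    a p : Level
    A : Set a
    n b : ℕ
    u v x : Fin n
    B : Subset n
    Bs : List (Subset n)

Meets : Fin n → Fin n → Subset n → Set
Meets u v B = u ∈ B ⊎ v ∈ B

meets? : (u v : Fin n) → Decidable (Meets u v)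
meets? u v B = (u ∈? B) ⊎-dec (v ∈? B)

meets⇒0<∣p∣ : Meets u v B → 0 < ∣ B ∣
meets⇒0<∣p∣ = [ x∈p⇒0<∣p∣ , x∈p⇒0<∣p∣ ]
  where
  x∈p⇒0<∣p∣ : x ∈ B → 0 < ∣ B ∣
  x∈p⇒0<∣p∣ x∈B = ≤-trans (s≤s z≤n) (x∈p⇒∣p-x∣<∣p∣ x∈B)

x∈p∧∣p∣≤1+b⇒∣p-x∣≤b : x ∈ B → ∣ B ∣ ≤ suc b → ∣ B - x ∣ ≤ b
x∈p∧∣p∣≤1+b⇒∣p-x∣≤b x∈B ∣B∣≤1+b = ≤-pred (≤-trans (x∈p⇒∣p-x∣<∣p∣ x∈B) ∣B∣≤1+b)

meets∧∉⇒∈ : Meets u v B → u ∉ B → v ∈ B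
meets∧∉⇒∈ (inj₁ u∈B) u∉B = contradiction u∈B u∉B
meets∧∉⇒∈ (inj₂ v∈B) _   = v∈B

∉∧∈⇒≢ : u ∉ B → x ∈ B → u ≢ x
∉∧∈⇒≢ u∉B x∈B refl = u∉B x∈B

meets-remove : u ≢ x → v ≢ x → Meets u v B → Meets u v (B - x)
meets-remove u≢x v≢x = Sum.map (λ u∈B → x∈p∧x≢y⇒x∈p-y u∈B u≢x) (λ v∈B → x∈p∧x≢y⇒x∈p-y v∈B v≢x)

-- A skew set-pair system (Aᵢ, Bᵢ) in the sense of Bollobás, with two-element
-- sets Aᵢ = {uᵢ, vᵢ}: Aᵢ is disjoint from Bᵢ and meets every Bⱼ further down the list.
data Skew {n} : List (Subset n) → Set where
  []   : Skew []
  cons : ∀ {B Bs} u v → u ∉ B → v ∉ B → All (Meets u v) Bs → Skew Bs → Skew (B ∷ Bs)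

skew-filter : {P : Pred (Subset n) p} (P? : Decidable P) → Skew Bs → Skew (filter P? Bs)
skew-filter P? [] = []
skew-filter P? (cons {B} u v u∉B v∉B meets skew) with does (P? B)
... | true  = cons u v u∉B v∉B (filter⁺ P? meets) (skew-filter P? skew)
... | false = skew-filter P? skew

skew-remove : All (x ∈_) Bs → Skew Bs → Skew (map (_- x) Bs)
skew-remove [] [] = []
skew-remove (x∈B ∷ x∈Bs) (cons u v u∉B v∉B meets skew) =
  cons u v (u∉B ∘ p─q⊆p _ _) (v∉B ∘ p─q⊆p _ _)
       (map⁺ (All.map (meets-remove (∉∧∈⇒≢ u∉B x∈B) (∉∧∈⇒≢ v∉B x∈B)) meets))
       (skew-remove x∈Bs skew)

length-filter+length-filter-∁ : {P : Pred A p} (P? : Decidable P) (xs : List A) →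
                                 length (filter P? xs) + length (filter (∁? P?) xs) ≡ length xs
length-filter+length-filter-∁ P? [] = refl
length-filter+length-filter-∁ P? (x ∷ xs) with does (P? x)
... | true  = cong suc (length-filter+length-filter-∁ P? xs)
... | false = trans (+-suc _ _) (cong suc (length-filter+length-filter-∁ P? xs))

-- Split the tail into the sets containing u and the rest, which contain v;
-- deleting u, resp. v, from them leaves two skew systems of smaller sets.
skew-length< : ∀ b {Bs : List (Subset n)} → Skew Bs → All ((_≤ b) ∘ ∣_∣) Bs → length Bs < 2 ^ suc b
skew-length< b [] [] = m^n>0 2 (suc b)
skew-length< zero (cons _ _ _ _ [] _) _ = s≤s (s≤s z≤n)
skew-length< zero (cons _ _ _ _ (meets ∷ _) _) (_ ∷ ∣B∣≤0 ∷ _) =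
  contradiction (<-≤-trans (meets⇒0<∣p∣ meets) ∣B∣≤0) λ ()
skew-length< (suc b) {B ∷ Bs} (cons u v _ _ meets skew) (_ ∷ sizes) = begin-strict
  suc (length Bs)                               ≡⟨ cong suc (length-filter+length-filter-∁ (u ∈?_) Bs) ⟨
  suc (length through + length avoiding)        <⟨ n<1+n _ ⟩
  suc (suc (length through + length avoiding))  ≡⟨ cong suc (+-suc _ _) ⟨
  suc (length through) + suc (length avoiding)  ≤⟨ +-mono-≤ length-through< length-avoiding< ⟩
  2 ^ suc b + 2 ^ suc b                         ≡⟨ cong (2 ^ suc b +_) (+-identityʳ _) ⟨
  2 ^ suc (suc b)                               ∎
  where
  open ≤-Reasoning
  through avoiding : List (Subset _)
  through  = filter (u ∈?_) Bs
  avoiding = filter (∁? (u ∈?_)) Bs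

  length-after-removing< : ∀ x {Cs} → All (x ∈_) Cs → Skew Cs → All ((_≤ suc b) ∘ ∣_∣) Cs →
                           length Cs < 2 ^ suc b
  length-after-removing< x {Cs} x∈Cs skewCs sizesCs =
    subst (_< 2 ^ suc b) (length-map (_- x) Cs)
      (skew-length< b (skew-remove x∈Cs skewCs)
        (map⁺ (All.zipWith (uncurry x∈p∧∣p∣≤1+b⇒∣p-x∣≤b) (x∈Cs , sizesCs))))

  length-through< : length through < 2 ^ suc b
  length-through< = length-after-removing< u (all-filter (u ∈?_) Bs) (skew-filter _ skew) (filter⁺ _ sizes)

  v∈avoiding : All (v ∈_) avoiding
  v∈avoiding = All.zipWith (λ (u∉C , meets) → meets∧∉⇒∈ meets u∉C)
                           (all-filter (∁? (u ∈?_)) Bs , filter⁺ _ meets)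

  length-avoiding< : length avoiding < 2 ^ suc b
  length-avoiding< = length-after-removing< v v∈avoiding (skew-filter _ skew) (filter⁺ _ sizes)

Admissible : List (Subset n) → Fin n → Fin n → Set
Admissible Cs u v = u ≢ v × All (Meets u v) Cs

admissible? : (Cs : List (Subset n)) (u v : Fin n) → Dec (Admissible Cs u v)
admissible? Cs u v = ¬? (u ≟ v) ×-dec All.all? (meets? u v) Cs

admissible-sym : ∀ {Cs : List (Subset n)} → Admissible Cs u v → Admissible Cs v u
admissible-sym (u≢v , meets) = u≢v ∘ ≡.sym , All.map Sum.swap meets

hypothesis : List (Subset n) → Graph n
hypothesis Cs = record
  { adj   = λ u v → does (admissible? Cs u v)
  ; sym   = λ u v → does-⇔ (mk⇔ admissible-sym admissible-sym) (admissible? Cs u v) (admissible? Cs v u)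
  ; irref = λ u → dec-false (admissible? Cs u u) (λ (u≢u , _) → u≢u refl)
  }

learner : Learner
learner _ = hypothesis

hypothesis-edge⇒admissible : ∀ {Cs : List (Subset n)} → adj (hypothesis Cs) u v ≡ true → Admissible Cs u v
hypothesis-edge⇒admissible {u = u} {v} {Cs} edge = invert (subst (Reflects _) edge (proof (admissible? Cs u v)))

edge⇒hypothesis-edge : ∀ (G : Graph n) {Cs} → All (IsVertexCover G) Cs →
                       adj G u v ≡ true → adj (hypothesis Cs) u v ≡ true
edge⇒hypothesis-edge G {Cs} covers edge = dec-true (admissible? Cs _ _) (u≢v , All.map (λ cover → cover _ _ edge) covers)
  where
  u≢v : _ ≢ _
  u≢v refl = contradiction (trans (≡.sym edge) (irref G _)) λ ()

cover-of-hypothesis⇒cover : ∀ (G : Graph n) {Cs C} → All (IsVertexCover G) Cs →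
                            IsVertexCover (hypothesis Cs) C → IsVertexCover G C
cover-of-hypothesis⇒cover G covers cover u v edge = cover u v (edge⇒hypothesis-edge G covers edge)

counterexample⇒positive : ∀ {k} (G : Graph n) {Cs C} → All (IsVertexCover G) Cs →
                          Counterexample k G (hypothesis Cs) C → Φ k G C × ¬ Φ k (hypothesis Cs) C
counterexample⇒positive G covers (inj₁ positive) = positive
counterexample⇒positive G covers (inj₂ ((cover , size) , ¬φ)) =
  contradiction (cover-of-hypothesis⇒cover G covers cover , size) ¬φ

edge-covered? : (H : Graph n) (C : Subset n) (u v : Fin n) → Dec (adj H u v ≡ true → Meets u v C)
edge-covered? H C u v = (adj H u v Bool.≟ true) →-dec meets? u v C

uncovered-edge : ∀ (H : Graph n) {C} → ¬ IsVertexCover H C → ∃₂ λ u v → adj H u v ≡ true × ¬ Meets u v C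
uncovered-edge H {C} ¬cover
  with u , ¬∀covered ← ¬∀⟶∃¬ _ _ (λ u → all? (edge-covered? H C u)) ¬cover
  with v , ¬covered ← ¬∀⟶∃¬ _ _ (edge-covered? H C u) ¬∀covered
  = u , v , decidable-stable (adj H u v Bool.≟ true) (λ ¬edge → ¬covered (λ edge → contradiction edge ¬edge))
      , λ meets → ¬covered (λ _ → meets)

skew-∷ : ∀ {Cs : List (Subset n)} {C} → Skew Cs → ¬ IsVertexCover (hypothesis Cs) C → Skew (C ∷ Cs)
skew-∷ {Cs = Cs} skew ¬cover with u , v , edge , ¬meets ← uncovered-edge (hypothesis Cs) ¬cover =
  cons u v (¬meets ∘ inj₁) (¬meets ∘ inj₂) (proj₂ (hypothesis-edge⇒admissible edge)) skew

run⇒positive×skew : ∀ {k G Cs} → Run k learner n G Cs → All (Φ k G) Cs × Skew Cs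
run⇒positive×skew start = [] , []
run⇒positive×skew {G = G} (step run counterexample)
  with φs , skew ← run⇒positive×skew run
  with φ , ¬φ ← counterexample⇒positive G (All.map proj₁ φs) counterexample
  = φ ∷ φs , skew-∷ skew (λ cover → ¬φ (cover , proj₂ φ))

1+k≤k*2^k : ∀ {k} → 1 ≤ k → suc k ≤ k * 2 ^ k
1+k≤k*2^k {k} 1≤k = begin
  suc k        ≡⟨ +-comm 1 k ⟩
  k + 1        ≤⟨ +-monoʳ-≤ k 1≤k ⟩
  k + k        ≡⟨ cong (k +_) (+-identityʳ k) ⟨
  2 * k        ≡⟨ *-comm 2 k ⟩
  k * 2        ≤⟨ *-monoʳ-≤ k (^-monoʳ-≤ 2 1≤k) ⟩
  k * 2 ^ k    ∎
  where open ≤-Reasoning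

theorem2p6 : (k : ℕ) → 1 ≤ k → Σ Learner (λ L → (n : ℕ) → (G : Graph n) → (cs : List (Subset n)) → Run k L n G cs → length cs < 2 ^ (k * 2 ^ k))
theorem2p6 k 1≤k = learner , λ n G cs run →
  let φs , skew = run⇒positive×skew run
  in <-≤-trans (skew-length< k skew (All.map (≤-reflexive ∘ proj₂) φs))
               (^-monoʳ-≤ 2 (1+k≤k*2^k 1≤k))
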